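{- The $3$-uniform hypergraphs $O_R$ and $O_B$ on vertex set $\{t,b,p,q,r,s,u\}$ with edge sets \[ E(O_R)=\{\{t,p,q\},\{t,r,s\},\{b,q,r\},\{b,p,s\},\{u,p,q\}\},\qquad E(O_B)=\{\{t,p,r\},\{t,p,s\},\{b,p,q\},\{b,r,s\},\{u,p,q\}\} \] are both opaque.
   Context: For a $k$-uniform hypergraph $H=([n],E)$ and $x\in\mathbb{C}^n$ write $x^e=\prod_{v\in e}x_v$. $(\rho,y)$ is an eigenpair of $H$ if $\rho y_i^{k-1}=\sum_{e\ni i}y^{e\setminus\{i\}}$ for all $i$; for connected $H$ the principal eigenpair is the unique one with $y$ strictly positive and $\|y\|_k=1$. The clique-shadow $\partial^*H$ is the multigraph on the same vertex set where $u\neq v$ are joined by $|\{e\in E:u,v\in e\}|$ parallel edges; its principal eigenvector is the positive unit ($\ell_2$) Perron eigenvector of its adjacency (co-occurrence) matrix. The spectral ranking of $H$ (resp. $\partial^*H$) is the ranking of vertices by their principal eigenvector entries, where vertex $v$ has rank $r$ if exactly $r-1$ distinct entry values are strictly larger than the entry at $v$. A hypergraph $H$ is opaque if its spectral ranking differs from the spectral ranking of $\partial^*H$. -}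

module Defs where

open import Data.Nat using (ℕ; zero; suc)
import Data.Nat
open import Data.Bool using (Bool; _∧_; _∨_; if_then_else_)
open import Relation.Nullary.Decidable using (⌊_⌋)
open import Data.Fin using (Fin; zero; suc; _≟_)
open import Data.List using (List; []; _∷_; length)
open import Data.List.Membership.Propositional using (_∈_)
open import Data.List.Relation.Unary.All using (All)
open import Data.Product using (Σ; ∃; _×_; _,_)
open import Data.Sum using (_⊎_)
open import Relation.Nullary using (¬_; yes; no)
open import Relation.Binary.PropositionalEquality using (_≡_; _≢_)
open import Algebra.Structures using (IsCommutativeRing)
open import Relation.Binary.Structures using (IsStrictTotalOrder)

-- The real numbers, axiomatised (stdlib has no reals) as a
-- Dedekind-complete ordered field.  Any model is isomorphic to ℝ.

record RealField : Set₁ where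
  infixl 6 _+_
  infixl 7 _*_
  infix 4 _<_ _≤_
  field
    Carrier : Set
    0# 1#   : Carrier
    _+_ _*_ : Carrier → Carrier → Carrier
    -_      : Carrier → Carrier
    _<_     : Carrier → Carrier → Set
    isCommutativeRing : IsCommutativeRing _≡_ _+_ _*_ -_ 0# 1#
    0≢1     : 0# ≢ 1#
    inverse : ∀ x → x ≢ 0# → ∃ λ y → x * y ≡ 1#
    isStrictTotalOrder : IsStrictTotalOrder _≡_ _<_
    +-mono-< : ∀ {x y} z → x < y → x + z < y + z
    *-pos    : ∀ {x y} → 0# < x → 0# < y → 0# < x * y

  _≤_ : Carrier → Carrier → Set
  x ≤ y = x < y ⊎ x ≡ y

  field
    complete : (P : Carrier → Set) → ∃ P → (∃ λ b → ∀ x → P x → x ≤ b) →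
               ∃ λ s → (∀ x → P x → x ≤ s) × (∀ b → (∀ x → P x → x ≤ b) → s ≤ b)

-- 3-uniform hypergraphs on Fin n: a list of edges, each edge a triple of
-- pairwise distinct vertices (an edge {a,b,c} is stored as (a , b , c)).

Edge : ℕ → Set
Edge n = Fin n × Fin n × Fin n

Hypergraph3 : ℕ → Set
Hypergraph3 n = List (Edge n)

inE : ∀ {n} → Fin n → Edge n → Bool
inE i (a , b , c) = ⌊ i ≟ a ⌋ ∨ ⌊ i ≟ b ⌋ ∨ ⌊ i ≟ c ⌋

module _ (ℝ : RealField) where
  open RealField ℝ

  fromℕ : ℕ → Carrier
  fromℕ zero = 0#
  fromℕ (suc k) = 1# + fromℕ k

  ∑ : ∀ {n} → (Fin n → Carrier) → Carrier
  ∑ {zero} f = 0#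
  ∑ {suc n} f = f zero + ∑ (λ i → f (suc i))

  ∑E : ∀ {n} → Hypergraph3 n → (Edge n → Carrier) → Carrier
  ∑E [] f = 0#
  ∑E (e ∷ es) f = f e + ∑E es f

  term : ∀ {n} → (Fin n → Carrier) → Fin n → Edge n → Carrier
  term y i (a , b , c) with i ≟ a | i ≟ b | i ≟ c
  ... | yes _ | _ | _ = y b * y c
  ... | no _ | yes _ | _ = y a * y c
  ... | no _ | no _ | yes _ = y a * y b
  ... | no _ | no _ | no _ = 0#

  IsEigenpair : ∀ {n} → Hypergraph3 n → Carrier → (Fin n → Carrier) → Set
  IsEigenpair H ρ y = ∀ i → ρ * (y i * y i) ≡ ∑E H (term y i)

  IsPrincipalEigenpair : ∀ {n} → Hypergraph3 n → Carrier → (Fin n → Carrier) → Set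
  IsPrincipalEigenpair H ρ y =
    IsEigenpair H ρ y × (∀ i → 0# < y i) × ∑ (λ i → y i * y i * y i) ≡ 1#

  -- clique-shadow ∂*H: adjacency (co-occurrence) matrix,
  -- A u v = |{e ∈ E : u , v ∈ e}| for u ≠ v, and A u u = 0
  shadowAdj : ∀ {n} → Hypergraph3 n → Fin n → Fin n → ℕ
  shadowAdj H u v with u ≟ v
  ... | yes _ = 0
  ... | no _ = countBoth H
    where
      countBoth : Hypergraph3 _ → ℕ
      countBoth [] = 0
      countBoth (e ∷ es) = (if inE u e ∧ inE v e then 1 else 0) Data.Nat.+ countBoth es

  IsShadowPrincipal : ∀ {n} → Hypergraph3 n → Carrier → (Fin n → Carrier) → Set
  IsShadowPrincipal H λ' x =
    (∀ u → ∑ (λ v → fromℕ (shadowAdj H u v) * x v) ≡ λ' * x u) ×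
    (∀ u → 0# < x u) × ∑ (λ u → x u * x u) ≡ 1#

  -- spectral ranking: vertex v has rank r iff exactly r - 1 distinct entry
  -- values are strictly larger than the entry at v.
  HasRank : ∀ {n} → (Fin n → Carrier) → Fin n → ℕ → Set
  HasRank {n} y v r = Σ (List (Fin n)) λ S →
    (suc (length S) ≡ r) ×
    (∀ w → w ∈ S → y v < y w) ×
    (∀ w w′ → w ∈ S → w′ ∈ S → y w ≡ y w′ → w ≡ w′) ×
    (∀ w → y v < y w → Σ (Fin n) λ w′ → w′ ∈ S × y w′ ≡ y w)

  SameRanking : ∀ {n} → (Fin n → Carrier) → (Fin n → Carrier) → Set
  SameRanking y x = ∀ v r → (HasRank y v r → HasRank x v r) × (HasRank x v r → HasRank y v r)

  Opaque : ∀ {n} → Hypergraph3 n → Set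
  Opaque H = ∀ ρ y λ' x → IsPrincipalEigenpair H ρ y → IsShadowPrincipal H λ' x →
             ¬ SameRanking y x

module Vertices where
  t b p q r s u : Fin 7
  t = zero
  b = suc zero
  p = suc (suc zero)
  q = suc (suc (suc zero))
  r = suc (suc (suc (suc zero)))
  s = suc (suc (suc (suc (suc zero))))
  u = suc (suc (suc (suc (suc (suc zero)))))

open Vertices

O-R : Hypergraph3 7
O-R = (t , p , q) ∷ (t , r , s) ∷ (b , q , r) ∷ (b , p , s) ∷ (u , p , q) ∷ []

O-B : Hypergraph3 7
O-B = (t , p , r) ∷ (t , p , s) ∷ (b , p , q) ∷ (b , r , s) ∷ (u , p , q) ∷ []

-- In O-R the vertices t and b lie in the same number of hyperedges with every
-- other vertex, so their rows of the co-occurrence matrix agree and the Perron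
-- vector x of the shadow has x t = x b.  In the hypergraph, y t = y b would give
-- (y p − y r)(y q − y s) = 0 from the eigen-equations at t and b, and then the
-- eigen-equations at p, r (or at q, s) would force the product y u · y q (or
-- y u · y p) of positive entries to vanish.  So the hypergraph ranks t and b
-- apart while its shadow ranks them equally.
--
-- In O-B the entries are separated numerically: y q < y b but x b < x q.  For an
-- integer approximation N of an eigenvector, the largest ratio (entry / N) bounds
-- the eigenvalue from above (Collatz–Wielandt).  Scaling N down until c · N
-- touches the eigenvector from below at some vertex i, the eigen-equation at a
-- vertex with a known upper bound bounds a neighbour from above, since all other
-- terms are at least their c · N values.  Along a path from i this ends with an
-- upper bound on y q below the lower bound c · N b of y b, and likewise on x b
-- below c · N q.

module Submission where

open import Defs
open import Algebra.Bundles using (CommutativeRing; RawRing)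
open import Data.Bool using (true; false)
open import Data.Empty using (⊥-elim)
open import Data.Fin as Fin using (Fin; zero; suc)
open import Data.Fin.Properties using (all?)
open import Data.List using (List; []; _∷_; map; allFin; lookup; length; filter; deduplicate)
import Data.List.Extrema
open import Data.List.Membership.Propositional using (_∈_; find)
open import Data.List.Membership.Propositional.Properties
  using (∈-allFin; ∈-filter⁺; ∈-filter⁻; ∈-deduplicate⁻)
open import Data.List.Properties using (length-removeAt′)
import Data.List.Relation.Unary.All as All
open import Data.List.Relation.Unary.AllPairs using (AllPairs; []; _∷_)
open import Data.List.Relation.Unary.Any as Any using (here; there; index; _─_)
import Data.List.Relation.Unary.Any.Properties as Anyₚ
open import Data.List.Relation.Unary.Unique.DecSetoid.Properties using (deduplicate-!)
open import Data.Maybe using (Maybe; just; nothing)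
open import Data.Nat as ℕ using (ℕ; zero; suc)
open import Data.Nat.ListAction using (sum)
open import Algebra.Definitions.RawMonoid ℕ.+-0-rawMonoid using () renaming (sum to ∑ℕ)
import Data.Nat.Properties as ℕ
open import Data.Product using (_×_; _,_; proj₁; proj₂; ∃-syntax)
open import Data.Product.Properties using (≡-dec)
open import Data.Sum using (_⊎_; inj₁; inj₂)
open import Function using (_$_; _∘_)
open import Relation.Binary.Bundles using (StrictTotalOrder; DecSetoid)
import Relation.Binary.Construct.On as On
open import Relation.Binary.Definitions using (tri<; tri≈; tri>)
open import Relation.Binary.PropositionalEquality as ≡ using (_≡_; _≢_)
import Relation.Binary.Reasoning.StrictPartialOrder
open import Relation.Nullary using (¬_; yes; no)
open import Relation.Nullary.Decidable using (True; from-yes; toWitness; T?)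

module IntegerCoefficientSolver {c ℓ} (R : CommutativeRing c ℓ) where
  open CommutativeRing R
  open import Algebra.Properties.AbelianGroup +-abelianGroup using (⁻¹-anti-homo‿-; ⁻¹-∙-comm)
  open import Algebra.Properties.CommutativeSemigroup +-commutativeSemigroup using (interchange)
  open import Algebra.Properties.Ring ring using (-0#≈0#; x[y-z]≈xy-xz; [y-z]x≈yx-zx)
  open import Algebra.Properties.Semiring.Mult semiring as Mult using (×-homo-+; ×1-homo-*)
  open import Algebra.Solver.Ring.AlmostCommutativeRing
    using (_-Raw-AlmostCommutative⟶_; fromCommutativeRing)
  open import Relation.Binary.Reasoning.Setoid setoid

  -- m − n, kept with min m n ≡ 0 so that equal integers have equal
  -- representations and the solver can compare coefficients by computation.
  Difference : Set
  Difference = ℕ × ℕ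

  normal : ℕ → ℕ → Difference
  normal (suc m) (suc n) = normal m n
  normal m       n       = m , n

  ι : ℕ → Carrier
  ι n = n Mult.× 1#

  ⟦_⟧ : Difference → Carrier
  ⟦ m , n ⟧ = ι m - ι n

  -‿interchange : ∀ a b c d → (a + b) - (c + d) ≈ (a - c) + (b - d)
  -‿interchange a b c d = begin
    (a + b) - (c + d)       ≈⟨ +-congˡ (⁻¹-∙-comm c d) ⟨
    (a + b) + (- c + - d)   ≈⟨ interchange a b (- c) (- d) ⟩
    (a - c) + (b - d)       ∎

  ⟦normal⟧ : ∀ m n → ⟦ normal m n ⟧ ≈ ⟦ m , n ⟧
  ⟦normal⟧ zero    n       = refl
  ⟦normal⟧ (suc m) zero    = refl
  ⟦normal⟧ (suc m) (suc n) = begin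
    ⟦ normal m n ⟧            ≈⟨ ⟦normal⟧ m n ⟩
    ι m - ι n                 ≈⟨ +-identityˡ _ ⟨
    0# + (ι m - ι n)          ≈⟨ +-congʳ (-‿inverseʳ 1#) ⟨
    (1# - 1#) + (ι m - ι n)   ≈⟨ -‿interchange _ _ _ _ ⟨
    ⟦ suc m , suc n ⟧         ∎

  _⊕_ _⊛_ : Difference → Difference → Difference
  (a , b) ⊕ (c , d) = normal (a ℕ.+ c) (b ℕ.+ d)
  (a , b) ⊛ (c , d) = normal (a ℕ.* c ℕ.+ b ℕ.* d) (a ℕ.* d ℕ.+ b ℕ.* c)

  ⊝_ : Difference → Difference
  ⊝ (a , b) = b , a

  Differences : RawRing _ _
  Differences = record
    { Carrier = Difference ; _≈_ = _≡_ ; _+_ = _⊕_ ; _*_ = _⊛_ ; -_ = ⊝_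
    ; 0# = 0 , 0 ; 1# = 1 , 0 }

  ⟦⊕⟧ : ∀ p q → ⟦ p ⊕ q ⟧ ≈ ⟦ p ⟧ + ⟦ q ⟧
  ⟦⊕⟧ (a , b) (c , d) = begin
    ⟦ normal (a ℕ.+ c) (b ℕ.+ d) ⟧    ≈⟨ ⟦normal⟧ (a ℕ.+ c) (b ℕ.+ d) ⟩
    ι (a ℕ.+ c) - ι (b ℕ.+ d)         ≈⟨ +-cong (×-homo-+ 1# a c) (-‿cong (×-homo-+ 1# b d)) ⟩
    (ι a + ι c) - (ι b + ι d)         ≈⟨ -‿interchange _ _ _ _ ⟩
    ⟦ a , b ⟧ + ⟦ c , d ⟧              ∎

  ⟦⊛⟧ : ∀ p q → ⟦ p ⊛ q ⟧ ≈ ⟦ p ⟧ * ⟦ q ⟧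
  ⟦⊛⟧ (a , b) (c , d) = begin
    ⟦ normal (a ℕ.* c ℕ.+ b ℕ.* d) (a ℕ.* d ℕ.+ b ℕ.* c) ⟧
      ≈⟨ ⟦normal⟧ (a ℕ.* c ℕ.+ b ℕ.* d) (a ℕ.* d ℕ.+ b ℕ.* c) ⟩
    ι (a ℕ.* c ℕ.+ b ℕ.* d) - ι (a ℕ.* d ℕ.+ b ℕ.* c)
      ≈⟨ +-cong (×-homo-+ 1# (a ℕ.* c) (b ℕ.* d)) (-‿cong (×-homo-+ 1# (a ℕ.* d) (b ℕ.* c))) ⟩
    (ι (a ℕ.* c) + ι (b ℕ.* d)) - (ι (a ℕ.* d) + ι (b ℕ.* c))
      ≈⟨ +-cong (+-cong (×1-homo-* a c) (×1-homo-* b d))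
                (-‿cong (+-cong (×1-homo-* a d) (×1-homo-* b c))) ⟩
    (A * C + B * D) - (A * D + B * C)
      ≈⟨ -‿interchange _ _ _ _ ⟩
    (A * C - A * D) + (B * D - B * C)
      ≈⟨ +-congˡ (⁻¹-anti-homo‿- (B * C) (B * D)) ⟨
    (A * C - A * D) - (B * C - B * D)
      ≈⟨ +-cong (x[y-z]≈xy-xz A C D) (-‿cong (x[y-z]≈xy-xz B C D)) ⟨
    A * (C - D) - B * (C - D)
      ≈⟨ [y-z]x≈yx-zx (C - D) A B ⟨
    (A - B) * (C - D)
      ∎
    where
    A B C D : Carrier
    A = ι a
    B = ι b
    C = ι c
    D = ι d

  homomorphism : Differences -Raw-AlmostCommutative⟶ fromCommutativeRing R
  homomorphism = record
    { ⟦_⟧    = ⟦_⟧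
    ; +-homo = ⟦⊕⟧
    ; *-homo = ⟦⊛⟧
    ; -‿homo = λ (a , b) → sym (⁻¹-anti-homo‿- (ι a) (ι b))
    ; 0-homo = trans (+-congˡ -0#≈0#) (+-identityʳ 0#)
    ; 1-homo = trans (+-congˡ -0#≈0#) (trans (+-identityʳ _) (+-identityʳ 1#))
    }

  ⟦⟧-cong? : ∀ p q → Maybe (⟦ p ⟧ ≈ ⟦ q ⟧)
  ⟦⟧-cong? p q with ≡-dec ℕ._≟_ ℕ._≟_ p q
  ... | yes ≡.refl = just refl
  ... | no _       = nothing

  open import Algebra.Solver.Ring Differences (fromCommutativeRing R) homomorphism ⟦⟧-cong? public
    using (solve; _:=_; _:+_; _:*_; _:-_; :-_)

module Opacity (ℝ : RealField) where
  open RealField ℝ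

  commutativeRing : CommutativeRing _ _
  commutativeRing = record { isCommutativeRing = isCommutativeRing }

  open CommutativeRing commutativeRing
    using ( _-_; +-assoc; +-comm; +-identityˡ; +-identityʳ; -‿inverseʳ
          ; *-assoc; *-comm; *-identityˡ; *-identityʳ; zeroˡ; zeroʳ; distribˡ; distribʳ)
  open IntegerCoefficientSolver commutativeRing using (solve; _:=_; _:+_; _:*_; _:-_; :-_)

  <-strictTotalOrder : StrictTotalOrder _ _ _
  <-strictTotalOrder = record { isStrictTotalOrder = isStrictTotalOrder }

  open StrictTotalOrder <-strictTotalOrder
    using (compare; _<?_; module Eq) renaming (irrefl to <-irrefl′; trans to <-trans; asym to <-asym)
  open import Relation.Binary.Construct.StrictToNonStrict {A = Carrier} _≡_ _<_ as ≤ using ()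
  open import Relation.Binary.Properties.StrictTotalOrder <-strictTotalOrder
    using (totalOrder) renaming (refl to ≤-refl; trans to ≤-trans)
  module ≤-Reasoning =
    Relation.Binary.Reasoning.StrictPartialOrder (StrictTotalOrder.strictPartialOrder <-strictTotalOrder)

  <-irrefl : ∀ {a} → ¬ a < a
  <-irrefl = <-irrefl′ ≡.refl

  <⇒≢ : ∀ {a b} → a < b → a ≢ b
  <⇒≢ a<b ≡.refl = <-irrefl a<b

  <-≤-trans : ∀ {a b c} → a < b → b ≤ c → a < c
  <-≤-trans = ≤.<-≤-trans <-trans (λ { ≡.refl p → p })

  ≤-<-trans : ∀ {a b c} → a ≤ b → b < c → a < c
  ≤-<-trans = ≤.≤-<-trans ≡.sym <-trans (λ { ≡.refl p → p })

  ≤-<-contradiction : ∀ {a b} → a ≤ b → ¬ b < a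
  ≤-<-contradiction a≤b b<a = <-irrefl (≤-<-trans a≤b b<a)

  +-monoˡ-< : ∀ {a b} c → a < b → c + a < c + b
  +-monoˡ-< {a} {b} c a<b = ≡.subst₂ _<_ (+-comm a c) (+-comm b c) (+-mono-< c a<b)

  +-monoʳ-≤ : ∀ {a b} c → a ≤ b → a + c ≤ b + c
  +-monoʳ-≤ c (inj₁ a<b)    = inj₁ (+-mono-< c a<b)
  +-monoʳ-≤ c (inj₂ ≡.refl) = ≤-refl

  +-monoˡ-≤ : ∀ {a b} c → a ≤ b → c + a ≤ c + b
  +-monoˡ-≤ {a} {b} c a≤b = ≡.subst₂ _≤_ (+-comm a c) (+-comm b c) (+-monoʳ-≤ c a≤b)

  +-mono-≤ : ∀ {a b c d} → a ≤ b → c ≤ d → a + c ≤ b + d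
  +-mono-≤ {b = b} {c} a≤b c≤d = ≤-trans (+-monoʳ-≤ c a≤b) (+-monoˡ-≤ b c≤d)

  +-cancelʳ-≤ : ∀ {a b} x → a + x ≤ b + x → a ≤ b
  +-cancelʳ-≤ {a} {b} x a+x≤b+x = ≡.subst₂ _≤_ (cancel a) (cancel b) (+-monoʳ-≤ (- x) a+x≤b+x)
    where
    cancel : ∀ a → a + x - x ≡ a
    cancel a = solve 2 (λ a x → a :+ x :- x := a) ≡.refl a x

  +-swap-outer : ∀ a b s → a + s + b ≡ b + s + a
  +-swap-outer = solve 3 (λ a b s → a :+ s :+ b := b :+ s :+ a) ≡.refl

  0<-⇒< : ∀ {a b} → 0# < b - a → a < b
  0<-⇒< {a} {b} 0<b-a =
    ≡.subst₂ _<_ (+-identityˡ a) (solve 2 (λ a b → b :- a :+ a := b) ≡.refl a b) (+-mono-< a 0<b-a)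

  <⇒0<- : ∀ {a b} → a < b → 0# < b - a
  <⇒0<- {a} {b} a<b = ≡.subst (_< b - a) (-‿inverseʳ a) (+-mono-< (- a) a<b)

  *-monoˡ-< : ∀ {a b c} → 0# < c → a < b → c * a < c * b
  *-monoˡ-< {a} {b} {c} 0<c a<b = 0<-⇒< (≡.subst (0# <_) c[b-a]≡cb-ca (*-pos 0<c (<⇒0<- a<b)))
    where
    c[b-a]≡cb-ca : c * (b - a) ≡ c * b - c * a
    c[b-a]≡cb-ca = solve 3 (λ a b c → c :* (b :- a) := c :* b :- c :* a) ≡.refl a b c

  *-monoˡ-≤ : ∀ {a b c} → 0# ≤ c → a ≤ b → c * a ≤ c * b
  *-monoˡ-≤ (inj₁ 0<c)    (inj₁ a<b)    = inj₁ (*-monoˡ-< 0<c a<b)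
  *-monoˡ-≤ (inj₂ ≡.refl) (inj₁ _)      = inj₂ (≡.trans (zeroˡ _) (≡.sym (zeroˡ _)))
  *-monoˡ-≤ _             (inj₂ ≡.refl) = ≤-refl

  *-monoʳ-≤ : ∀ {a b c} → 0# ≤ c → a ≤ b → a * c ≤ b * c
  *-monoʳ-≤ {a} {b} {c} 0≤c a≤b = ≡.subst₂ _≤_ (*-comm c a) (*-comm c b) (*-monoˡ-≤ 0≤c a≤b)

  *-mono-≤ : ∀ {a b c d} → 0# ≤ a → 0# ≤ d → a ≤ b → c ≤ d → a * c ≤ b * d
  *-mono-≤ 0≤a 0≤d a≤b c≤d = ≤-trans (*-monoˡ-≤ 0≤a c≤d) (*-monoʳ-≤ 0≤d a≤b)

  *-cancelˡ-< : ∀ {a b c} → 0# < c → c * a < c * b → a < b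
  *-cancelˡ-< {a} {b} 0<c ca<cb with compare a b
  ... | tri< a<b _ _    = a<b
  ... | tri≈ _ ≡.refl _ = ⊥-elim (<-irrefl ca<cb)
  ... | tri> _ _ b<a    = ⊥-elim (<-asym ca<cb (*-monoˡ-< 0<c b<a))

  *-cancelˡ-≤ : ∀ {a b c} → 0# < c → c * a ≤ c * b → a ≤ b
  *-cancelˡ-≤ {a} {b} 0<c ca≤cb with compare a b
  ... | tri< a<b _ _ = inj₁ a<b
  ... | tri≈ _ a≡b _ = inj₂ a≡b
  ... | tri> _ _ b<a = ⊥-elim (≤-<-contradiction ca≤cb (*-monoˡ-< 0<c b<a))

  *-cancelˡ-≡ : ∀ {a b c} → 0# < c → c * a ≡ c * b → a ≡ b
  *-cancelˡ-≡ {a} {b} {c} 0<c ca≡cb with compare a b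
  ... | tri< a<b _ _ = ⊥-elim (<-irrefl (≡.subst (_< c * b) ca≡cb (*-monoˡ-< 0<c a<b)))
  ... | tri≈ _ a≡b _ = a≡b
  ... | tri> _ _ b<a = ⊥-elim (<-irrefl (≡.subst (c * b <_) ca≡cb (*-monoˡ-< 0<c b<a)))

  *-scale-square : ∀ c a b → c * a * (c * b) ≡ c * c * (a * b)
  *-scale-square = solve 3 (λ c a b → c :* a :* (c :* b) := c :* c :* (a :* b)) ≡.refl

  0≤* : ∀ {a b} → 0# ≤ a → 0# ≤ b → 0# ≤ a * b
  0≤* {a} {b} 0≤a 0≤b = ≡.subst (_≤ a * b) (zeroʳ a) (*-monoˡ-≤ 0≤a 0≤b)

  0<+ : ∀ {a b} → 0# < a → 0# ≤ b → 0# < a + b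
  0<+ {a} {b} 0<a 0≤b = <-≤-trans 0<a (≡.subst (_≤ a + b) (+-identityʳ a) (+-monoˡ-≤ a 0≤b))

  0<1 : 0# < 1#
  0<1 with compare 0# 1#
  ... | tri< 0<1 _ _ = 0<1
  ... | tri≈ _ 0≡1 _ = ⊥-elim (0≢1 0≡1)
  ... | tri> _ _ 1<0 = ⊥-elim (<-asym 1<0 (≡.subst (0# <_) -1*-1≡1 (*-pos 0<-1 0<-1)))
    where
    0<-1 : 0# < - 1#
    0<-1 = ≡.subst (0# <_) (+-identityˡ (- 1#)) (<⇒0<- {1#} {0#} 1<0)
    -1*-1≡1 : - 1# * - 1# ≡ 1#
    -1*-1≡1 = ≡.trans (solve 1 (λ x → :- x :* :- x := x :* x) ≡.refl 1#) (*-identityˡ 1#)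

  x≡y⇒x-y≡0 : ∀ {a b} → a ≡ b → a - b ≡ 0#
  x≡y⇒x-y≡0 {a} ≡.refl = -‿inverseʳ a

  x-y≡0⇒x≡y : ∀ {a b} → a - b ≡ 0# → a ≡ b
  x-y≡0⇒x≡y {a} {b} a-b≡0 = begin
    a              ≡⟨ solve 2 (λ a b → a := a :- b :+ b) ≡.refl a b ⟩
    a - b + b      ≡⟨ ≡.cong (_+ b) a-b≡0 ⟩
    0# + b         ≡⟨ +-identityˡ b ⟩
    b              ∎
    where open ≡.≡-Reasoning

  nonzero-cancel : ∀ {a b} → a ≢ 0# → a * b ≡ 0# → b ≡ 0#
  nonzero-cancel {a} {b} a≢0 ab≡0 = let a⁻¹ , a*a⁻¹≡1 = inverse a a≢0 in begin
    b                ≡⟨ *-identityˡ b ⟨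
    1# * b           ≡⟨ ≡.cong (_* b) a*a⁻¹≡1 ⟨
    a * a⁻¹ * b      ≡⟨ solve 3 (λ a i b → a :* i :* b := i :* (a :* b)) ≡.refl a a⁻¹ b ⟩
    a⁻¹ * (a * b)    ≡⟨ ≡.cong (a⁻¹ *_) ab≡0 ⟩
    a⁻¹ * 0#         ≡⟨ zeroʳ a⁻¹ ⟩
    0#               ∎
    where open ≡.≡-Reasoning

  zero-product : ∀ {a b} → a * b ≡ 0# → a ≡ 0# ⊎ b ≡ 0#
  zero-product {a} ab≡0 with compare a 0#
  ... | tri< _ a≢0 _ = inj₂ (nonzero-cancel a≢0 ab≡0)
  ... | tri≈ _ a≡0 _ = inj₁ a≡0
  ... | tri> _ a≢0 _ = inj₂ (nonzero-cancel a≢0 ab≡0)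

  ι : ℕ → Carrier
  ι = fromℕ ℝ

  ι-+ : ∀ m n → ι (m ℕ.+ n) ≡ ι m + ι n
  ι-+ zero    n = ≡.sym (+-identityˡ (ι n))
  ι-+ (suc m) n = ≡.trans (≡.cong (1# +_) (ι-+ m n)) (≡.sym (+-assoc 1# (ι m) (ι n)))

  ι-* : ∀ m n → ι (m ℕ.* n) ≡ ι m * ι n
  ι-* zero    n = ≡.sym (zeroˡ (ι n))
  ι-* (suc m) n = begin
    ι (n ℕ.+ m ℕ.* n)      ≡⟨ ι-+ n (m ℕ.* n) ⟩
    ι n + ι (m ℕ.* n)      ≡⟨ ≡.cong (ι n +_) (ι-* m n) ⟩
    ι n + ι m * ι n        ≡⟨ ≡.cong (_+ ι m * ι n) (*-identityˡ (ι n)) ⟨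
    1# * ι n + ι m * ι n   ≡⟨ distribʳ (ι n) 1# (ι m) ⟨
    (1# + ι m) * ι n       ∎
    where open ≡.≡-Reasoning

  ι-*₃ : ∀ l m n → ι (l ℕ.* m ℕ.* n) ≡ ι l * ι m * ι n
  ι-*₃ l m n = ≡.trans (ι-* (l ℕ.* m) n) (≡.cong (_* ι n) (ι-* l m))

  ι-*-scaled : ∀ c m n → ι m * (c * ι n) ≡ c * ι (m ℕ.* n)
  ι-*-scaled c m n = ≡.trans (solve 3 (λ a c b → a :* (c :* b) := c :* (a :* b)) ≡.refl (ι m) c (ι n))
                             (≡.cong (c *_) (≡.sym (ι-* m n)))

  ι-*-swap : ∀ m a n → ι m * a * ι n ≡ a * ι (m ℕ.* n)
  ι-*-swap m a n = ≡.trans (solve 3 (λ b a c → b :* a :* c := a :* (b :* c)) ≡.refl (ι m) a (ι n))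
                           (≡.cong (a *_) (≡.sym (ι-* m n)))

  0<ι : ∀ {n} → 0 ℕ.< n → 0# < ι n
  0≤ι : ∀ n → 0# ≤ ι n
  0<ι {suc n} _ = 0<+ 0<1 (0≤ι n)
  0≤ι zero      = ≤-refl
  0≤ι (suc n)   = inj₁ (0<ι {suc n} ℕ.z<s)

  ι-mono-≤ : ∀ {m n} → m ℕ.≤ n → ι m ≤ ι n
  ι-mono-≤ {m} {n} m≤n = ≡.subst₂ _≤_ (+-identityʳ (ι m)) ι[m+[n∸m]]≡ιn (+-monoˡ-≤ (ι m) (0≤ι (n ℕ.∸ m)))
    where
    ι[m+[n∸m]]≡ιn : ι m + ι (n ℕ.∸ m) ≡ ι n
    ι[m+[n∸m]]≡ιn = ≡.trans (≡.sym (ι-+ m (n ℕ.∸ m))) (≡.cong ι (ℕ.m+[n∸m]≡n m≤n))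

  ι-mono-< : ∀ {m n} → m ℕ.< n → ι m < ι n
  ι-mono-< {m} {suc n} (ℕ.s≤s m≤n) = ≡.subst (_< ι (suc n)) (+-identityˡ (ι m))
    (<-≤-trans (+-mono-< (ι m) 0<1) (+-monoˡ-≤ 1# (ι-mono-≤ m≤n)))

  ι-∸ : ∀ m n → ι m ≤ ι n + ι (m ℕ.∸ n)
  ι-∸ m n = ≡.subst (ι m ≤_) (ι-+ n (m ℕ.∸ n)) (ι-mono-≤ (ℕ.m≤n+m∸n m n))

  ∑-cong : ∀ {n} {f g : Fin n → Carrier} → (∀ i → f i ≡ g i) → ∑ ℝ f ≡ ∑ ℝ g
  ∑-cong {zero}  f≗g = ≡.refl
  ∑-cong {suc n} f≗g = ≡.cong₂ _+_ (f≗g zero) (∑-cong (λ i → f≗g (suc i)))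

  ∑-mono-≤ : ∀ {n} {f g : Fin n → Carrier} → (∀ i → f i ≤ g i) → ∑ ℝ f ≤ ∑ ℝ g
  ∑-mono-≤ {zero}  f≤g = ≤-refl
  ∑-mono-≤ {suc n} f≤g = +-mono-≤ (f≤g zero) (∑-mono-≤ (λ i → f≤g (suc i)))

  *-distribˡ-∑ : ∀ {n} c (f : Fin n → Carrier) → c * ∑ ℝ f ≡ ∑ ℝ (λ i → c * f i)
  *-distribˡ-∑ {zero}  c f = zeroʳ c
  *-distribˡ-∑ {suc n} c f =
    ≡.trans (distribˡ c (f zero) _) (≡.cong (c * f zero +_) (*-distribˡ-∑ c (λ i → f (suc i))))

  ∑-ι : ∀ {n} (h : Fin n → ℕ) → ∑ ℝ (λ i → ι (h i)) ≡ ι (∑ℕ h)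
  ∑-ι {zero}  h = ≡.refl
  ∑-ι {suc n} h = ≡.trans (≡.cong (ι (h zero) +_) (∑-ι (λ i → h (suc i)))) (≡.sym (ι-+ (h zero) _))

  ∑-exchange : ∀ {n} {f g : Fin n → Carrier} → (∀ i → g i ≤ f i) → ∀ j → ∑ ℝ g + f j ≤ ∑ ℝ f + g j
  ∑-exchange {suc n} {f} {g} g≤f zero = ≡.subst (_≤ ∑ ℝ f + g zero) (+-swap-outer (f zero) (g zero) _)
    (+-monoʳ-≤ (g zero) (+-monoˡ-≤ (f zero) (∑-mono-≤ (λ i → g≤f (suc i)))))
  ∑-exchange {suc n} {f} {g} g≤f (suc j) = ≡.subst₂ _≤_ (≡.sym (+-assoc _ _ _)) (≡.sym (+-assoc _ _ _))
    (+-mono-≤ (g≤f zero) (∑-exchange (λ i → g≤f (suc i)) j))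

  0≤∑ : ∀ {n} {f : Fin n → Carrier} → (∀ i → 0# ≤ f i) → 0# ≤ ∑ ℝ f
  0≤∑ {zero}      _   = ≤-refl
  0≤∑ {suc n} {f} 0≤f = ≡.subst (_≤ ∑ ℝ f) (+-identityʳ 0#) (+-mono-≤ (0≤f zero) (0≤∑ (λ i → 0≤f (suc i))))

  ∑-≥-term : ∀ {n} {f : Fin n → Carrier} → (∀ i → 0# ≤ f i) → ∀ j → f j ≤ ∑ ℝ f
  ∑-≥-term {suc n} {f} 0≤f zero    =
    ≡.subst (_≤ ∑ ℝ f) (+-identityʳ (f zero)) (+-monoˡ-≤ (f zero) (0≤∑ (λ i → 0≤f (suc i))))
  ∑-≥-term {suc n} {f} 0≤f (suc j) =
    ≡.subst (_≤ ∑ ℝ f) (+-identityˡ (f (suc j))) (+-mono-≤ (0≤f zero) (∑-≥-term (λ i → 0≤f (suc i)) j))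

  module _ {n : ℕ} where

    ∑E-cong : ∀ (H : Hypergraph3 n) {f g} → (∀ e → f e ≡ g e) → ∑E ℝ H f ≡ ∑E ℝ H g
    ∑E-cong []      f≗g = ≡.refl
    ∑E-cong (e ∷ H) f≗g = ≡.cong₂ _+_ (f≗g e) (∑E-cong H f≗g)

    ∑E-mono-≤ : ∀ (H : Hypergraph3 n) {f g} → (∀ e → f e ≤ g e) → ∑E ℝ H f ≤ ∑E ℝ H g
    ∑E-mono-≤ []      f≤g = ≤-refl
    ∑E-mono-≤ (e ∷ H) f≤g = +-mono-≤ (f≤g e) (∑E-mono-≤ H f≤g)

    *-distribˡ-∑E : ∀ (H : Hypergraph3 n) c f → c * ∑E ℝ H f ≡ ∑E ℝ H (λ e → c * f e)
    *-distribˡ-∑E []      c f = zeroʳ c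
    *-distribˡ-∑E (e ∷ H) c f = ≡.trans (distribˡ c (f e) _) (≡.cong (c * f e +_) (*-distribˡ-∑E H c f))

    ∑E-ι : ∀ (H : Hypergraph3 n) (h : Edge n → ℕ) → ∑E ℝ H (λ e → ι (h e)) ≡ ι (sum (map h H))
    ∑E-ι []      h = ≡.refl
    ∑E-ι (e ∷ H) h = ≡.trans (≡.cong (ι (h e) +_) (∑E-ι H h)) (≡.sym (ι-+ (h e) _))

    ∑E-exchange : ∀ {H : Hypergraph3 n} {f g} → (∀ e → g e ≤ f e) →
                  ∀ {e} → e ∈ H → ∑E ℝ H g + f e ≤ ∑E ℝ H f + g e
    ∑E-exchange {e ∷ H} {f} {g} g≤f (here ≡.refl) =
      ≡.subst (_≤ ∑E ℝ (e ∷ H) f + g e) (+-swap-outer (f e) (g e) _)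
        (+-monoʳ-≤ (g e) (+-monoˡ-≤ (f e) (∑E-mono-≤ H g≤f)))
    ∑E-exchange {e′ ∷ H} g≤f (there e∈H) = ≡.subst₂ _≤_ (≡.sym (+-assoc _ _ _)) (≡.sym (+-assoc _ _ _))
      (+-mono-≤ (g≤f e′) (∑E-exchange g≤f e∈H))

  -- Extremal ratios

  module _ {n : ℕ} (y z : Fin (suc n) → Carrier) (0<z : ∀ w → 0# < z w) where
    open Data.List.Extrema totalOrder using (argmin; argmax; f[argmin]≤f[xs]; f[xs]≤f[argmax])

    private
      z≢0 : ∀ w → z w ≢ 0#
      z≢0 w = <⇒≢ (0<z w) ∘ ≡.sym

      ratio : Fin (suc n) → Carrier
      ratio w = y w * proj₁ (inverse (z w) (z≢0 w))

      ratio*z≡y : ∀ w → ratio w * z w ≡ y w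
      ratio*z≡y w = let z⁻¹ , z*z⁻¹≡1 = inverse (z w) (z≢0 w) in begin
        y w * z⁻¹ * z w    ≡⟨ solve 3 (λ a b c → a :* b :* c := a :* (c :* b)) ≡.refl (y w) z⁻¹ (z w) ⟩
        y w * (z w * z⁻¹)  ≡⟨ ≡.cong (y w *_) z*z⁻¹≡1 ⟩
        y w * 1#           ≡⟨ *-identityʳ (y w) ⟩
        y w                ∎
        where open ≡.≡-Reasoning

      touching : ∀ i → 0# < y i → 0# < ratio i × y i ≡ ratio i * z i
      touching i 0<yi = *-cancelˡ-< (0<z i) 0*zi<zi*ri , ≡.sym (ratio*z≡y i)
        where
        0*zi<zi*ri : z i * 0# < z i * ratio i
        0*zi<zi*ri = ≡.subst₂ _<_ (≡.sym (zeroʳ (z i))) (≡.trans (≡.sym (ratio*z≡y i)) (*-comm (ratio i) (z i))) 0<yi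

      scaled-below : ∀ {v w} → ratio v ≤ ratio w → ratio v * z w ≤ y w
      scaled-below {v} {w} rv≤rw = ≡.subst (ratio v * z w ≤_) (ratio*z≡y w) (*-monoʳ-≤ (inj₁ (0<z w)) rv≤rw)

      scaled-above : ∀ {v w} → ratio w ≤ ratio v → y w ≤ ratio v * z w
      scaled-above {v} {w} rw≤rv = ≡.subst (_≤ ratio v * z w) (ratio*z≡y w) (*-monoʳ-≤ (inj₁ (0<z w)) rw≤rv)

    min-ratio : (∀ w → 0# < y w) → ∃[ i ] ∃[ c ] 0# < c × (∀ w → c * z w ≤ y w) × y i ≡ c * z i
    min-ratio 0<y = i , ratio i , proj₁ (touching i (0<y i))
                  , (λ w → scaled-below (All.lookup minimal (∈-allFin w))) , proj₂ (touching i (0<y i))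
      where
      i : Fin (suc n)
      i = argmin ratio zero (allFin _)
      minimal : All.All (λ w → ratio i ≤ ratio w) (allFin _)
      minimal = f[argmin]≤f[xs] {f = ratio} zero (allFin _)

    max-ratio : (∀ w → 0# < y w) → ∃[ i ] ∃[ c ] 0# < c × (∀ w → y w ≤ c * z w) × y i ≡ c * z i
    max-ratio 0<y = i , ratio i , proj₁ (touching i (0<y i))
                  , (λ w → scaled-above (All.lookup maximal (∈-allFin w))) , proj₂ (touching i (0<y i))
      where
      i : Fin (suc n)
      i = argmax ratio zero (allFin _)
      maximal : All.All (λ w → ratio w ≤ ratio i) (allFin _)
      maximal = f[xs]≤f[argmax] {f = ratio} zero (allFin _)

  -- Spectral rankings

  ∈-─⁺ : ∀ {A : Set} {b c : A} {M} → c ∈ M → (b∈M : b ∈ M) → c ≢ b → c ∈ (M ─ b∈M)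
  ∈-─⁺ (here ≡.refl) (here ≡.refl) c≢b = ⊥-elim (c≢b ≡.refl)
  ∈-─⁺ (here ≡.refl) (there _)     _   = here ≡.refl
  ∈-─⁺ (there c∈M)   (here _)      _   = c∈M
  ∈-─⁺ (there c∈M)   (there b∈M)   c≢b = there (∈-─⁺ c∈M b∈M c≢b)

  -- A witness list of HasRank may repeat a vertex, so HasRank z v r does not pin
  -- down r; rank-> bounds r from below by any list of distinct values above v,
  -- and above v is a witness without repetitions.
  module Ranking {n : ℕ} (z : Fin n → Carrier) where
    value-decSetoid : DecSetoid _ _
    value-decSetoid = On.decSetoid Eq.decSetoid z
    open DecSetoid value-decSetoid using () renaming (_≟_ to _≟ᵥ_)

    Distinct : List (Fin n) → Set
    Distinct = AllPairs (λ a b → z a ≢ z b)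

    length-≤ : ∀ {L} M → Distinct L → (∀ {a} → a ∈ L → ∃[ b ] b ∈ M × z b ≡ z a) → length L ℕ.≤ length M
    length-≤ {[]}    M _                  _     = ℕ.z≤n
    length-≤ {a ∷ L} M (za≢zL ∷ distinct) cover with cover (here ≡.refl)
    ... | b , b∈M , zb≡za = ≡.subst (suc (length L) ℕ.≤_) (≡.sym (length-removeAt′ M (index b∈M)))
                              (ℕ.s≤s (length-≤ (M ─ b∈M) distinct cover′))
      where
      cover′ : ∀ {a′} → a′ ∈ L → ∃[ b′ ] b′ ∈ (M ─ b∈M) × z b′ ≡ z a′
      cover′ {a′} a′∈L with cover (there a′∈L)
      ... | b′ , b′∈M , zb′≡za′ = b′ , ∈-─⁺ b′∈M b∈M b′≢b , zb′≡za′
        where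
        b′≢b : b′ ≢ b
        b′≢b ≡.refl = All.lookup za≢zL a′∈L (≡.trans (≡.sym zb≡za) zb′≡za′)

    distinct-injective : ∀ {L a b} → Distinct L → a ∈ L → b ∈ L → z a ≡ z b → a ≡ b
    distinct-injective _              (here ≡.refl) (here ≡.refl) _     = ≡.refl
    distinct-injective (za≢zL ∷ _)    (here ≡.refl) (there b∈L)   za≡zb = ⊥-elim (All.lookup za≢zL b∈L za≡zb)
    distinct-injective (zb≢zL ∷ _)    (there a∈L)   (here ≡.refl) za≡zb =
      ⊥-elim (All.lookup zb≢zL a∈L (≡.sym za≡zb))
    distinct-injective (_ ∷ distinct) (there a∈L)   (there b∈L)   za≡zb = distinct-injective distinct a∈L b∈L za≡zb

    above : Fin n → List (Fin n)
    above v = deduplicate _≟ᵥ_ (filter (λ w → z v <? z w) (allFin n))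

    above-distinct : ∀ v → Distinct (above v)
    above-distinct v = deduplicate-! value-decSetoid (filter (λ w → z v <? z w) (allFin n))

    above-> : ∀ {v w} → w ∈ above v → z v < z w
    above-> {v} w∈ = proj₂ (∈-filter⁻ (λ w → z v <? z w) {xs = allFin n} (∈-deduplicate⁻ _≟ᵥ_ _ w∈))

    above-rank : ∀ v → HasRank ℝ z v (suc (length (above v)))
    above-rank v = above v , ≡.refl , (λ w → above->) , (λ w w′ → distinct-injective (above-distinct v)) , cover
      where
      cover : ∀ w → z v < z w → ∃[ w′ ] w′ ∈ above v × z w′ ≡ z w
      cover w zv<zw = find (Anyₚ.deduplicate⁺ _≟ᵥ_ ≡.trans
        (Any.map (λ w≡b → ≡.cong z (≡.sym w≡b)) (∈-filter⁺ (λ w → z v <? z w) (∈-allFin w) zv<zw)))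

    rank-> : ∀ {v r L} → HasRank ℝ z v r → Distinct L → (∀ {a} → a ∈ L → z v < z a) → length L ℕ.< r
    rank-> (S , ≡.refl , _ , _ , cover) distinct L>v = ℕ.s≤s (length-≤ S distinct (λ a∈L → cover _ (L>v a∈L)))

  ranking-differs : ∀ {n} {y x : Fin n → Carrier} {v w} → y v < y w → x w ≤ x v → ¬ SameRanking ℝ y x
  ranking-differs {y = y} {x} {v} {w} yv<yw xw≤xv same =
    ℕ.<-irrefl ≡.refl (ℕ.<-≤-trans (ℕ.s≤s⁻¹ y-bound) (ℕ.s≤s⁻¹ x-bound))
    where
    module Y = Ranking y
    module X = Ranking x

    x-bound : length (X.above v) ℕ.< suc (length (Y.above w))
    x-bound = X.rank-> (proj₁ (same w _) (Y.above-rank w)) (X.above-distinct v)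
                       (λ a∈ → ≤-<-trans xw≤xv (X.above-> a∈))

    y-bound : suc (length (Y.above w)) ℕ.< suc (length (X.above v))
    y-bound = Y.rank-> (proj₂ (same v _) (X.above-rank v))
                       (All.tabulate (λ a∈ → <⇒≢ (Y.above-> a∈)) ∷ Y.above-distinct w)
                       (λ { (here ≡.refl) → yv<yw ; (there a∈) → <-trans yv<yw (Y.above-> a∈) })

  -- Upper bounds from an approximate eigenvector

  -- In an eigen-equation r = a + (other terms) whose terms
  -- are bounded below termwise with total q · S, the share of a being q · T, the
  -- first hypothesis says the other terms are at least q · (S − T).  Together
  -- with r · K ≤ q · P this isolates a · K ≤ q · (P + T · K − S · K); truncated
  -- subtraction only weakens that bound.
  isolate-term : ∀ {q a r} (S T K P : ℕ) → 0# ≤ q → q * ι S + a ≤ r + q * ι T → r * ι K ≤ q * ι P →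
                 a * ι K ≤ q * ι (P ℕ.+ T ℕ.* K ℕ.∸ S ℕ.* K)
  isolate-term {q} {a} {r} S T K P 0≤q sum≤ rK≤qP = +-cancelʳ-≤ (q * ι (S ℕ.* K)) (begin
    a * ι K + q * ι (S ℕ.* K)        ≡⟨ ≡.cong (λ t → a * ι K + q * t) (ι-* S K) ⟩
    a * ι K + q * (ι S * ι K)        ≡⟨ solve 4 (λ a q s k → a :* k :+ q :* (s :* k) := (q :* s :+ a) :* k)
                                               ≡.refl a q (ι S) (ι K) ⟩
    (q * ι S + a) * ι K              ≤⟨ *-monoʳ-≤ (0≤ι K) sum≤ ⟩
    (r + q * ι T) * ι K              ≡⟨ solve 4 (λ r q t k → (r :+ q :* t) :* k := r :* k :+ q :* (t :* k))
                                               ≡.refl r q (ι T) (ι K) ⟩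
    r * ι K + q * (ι T * ι K)        ≤⟨ +-monoʳ-≤ _ rK≤qP ⟩
    q * ι P + q * (ι T * ι K)        ≡⟨ distribˡ q (ι P) _ ⟨
    q * (ι P + ι T * ι K)            ≡⟨ ≡.cong (q *_) (≡.trans (ι-+ P (T ℕ.* K)) (≡.cong (ι P +_) (ι-* T K))) ⟨
    q * ι (P ℕ.+ T ℕ.* K)            ≤⟨ *-monoˡ-≤ 0≤q (ι-∸ (P ℕ.+ T ℕ.* K) (S ℕ.* K)) ⟩
    q * (ι (S ℕ.* K) + ι M)          ≡⟨ solve 3 (λ q s m → q :* (s :+ m) := q :* m :+ q :* s)
                                               ≡.refl q (ι (S ℕ.* K)) (ι M) ⟩
    q * ι M + q * ι (S ℕ.* K)        ∎)
    where
    open ≤-Reasoning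
    M : ℕ
    M = P ℕ.+ T ℕ.* K ℕ.∸ S ℕ.* K

  module ScaledBounds {n : ℕ} (z : Fin n → Carrier) (c : Carrier) (N : Fin n → ℕ) where

    -- z w ≤ c · U / D.  A record, so that (U , D) can be read off the type of a
    -- bound: unification cannot invert ι.
    record ScaledBound (w : Fin n) (bound : ℕ × ℕ) : Set where
      constructor scaled
      field unscaled : z w * ι (proj₂ bound) ≤ c * ι (proj₁ bound)

    bound-at-touch : ∀ {i} → z i ≡ c * ι (N i) → ScaledBound i (N i , 1)
    bound-at-touch {i} zi≡cNi =
      scaled (inj₂ (≡.trans (≡.cong (z i *_) (+-identityʳ 1#)) (≡.trans (*-identityʳ (z i)) zi≡cNi)))

    bound-separates : ∀ {a b U D} → 0# < c → c * ι (N b) ≤ z b → ScaledBound a (U , D) →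
                      U ℕ.< N b ℕ.* D → z a < z b
    bound-separates {b = b} {U} {zero} _ _ _ U<Nb*0 = ⊥-elim (ℕ.n≮0 (≡.subst (U ℕ.<_) (ℕ.*-zeroʳ (N b)) U<Nb*0))
    bound-separates {a} {b} {U} {suc D} 0<c cNb≤zb (scaled zaD≤cU) U<NbD = *-cancelˡ-< (0<ι {suc D} ℕ.z<s) (begin-strict
      ι (suc D) * z a            ≡⟨ *-comm _ _ ⟩
      z a * ι (suc D)            ≤⟨ zaD≤cU ⟩
      c * ι U                    <⟨ *-monoˡ-< 0<c (ι-mono-< U<NbD) ⟩
      c * ι (N b ℕ.* suc D)      ≡⟨ ≡.cong (c *_) (ι-* (N b) (suc D)) ⟩
      c * (ι (N b) * ι (suc D))  ≡⟨ solve 3 (λ c n d → c :* (n :* d) := d :* (c :* n)) ≡.refl c (ι (N b)) (ι (suc D)) ⟩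
      ι (suc D) * (c * ι (N b))  ≤⟨ *-monoˡ-≤ (0≤ι (suc D)) cNb≤zb ⟩
      ι (suc D) * z b            ∎)
      where open ≤-Reasoning

  module MatrixBounds {n : ℕ} (A : Fin (suc n) → Fin (suc n) → ℕ) {λ′ : Carrier} {x : Fin (suc n) → Carrier}
                      (eigen : ∀ u → ∑ ℝ (λ w → ι (A u w) * x w) ≡ λ′ * x u) (0<x : ∀ w → 0# < x w) where

    rowSum : (Fin (suc n) → ℕ) → Fin (suc n) → ℕ
    rowSum N u = ∑ℕ (λ w → A u w ℕ.* N w)

    row-ι : ∀ c (N : Fin (suc n) → ℕ) u → ∑ ℝ (λ w → c * ι (A u w ℕ.* N w)) ≡ c * ι (rowSum N u)
    row-ι c N u = ≡.trans (≡.sym (*-distribˡ-∑ c (λ w → ι (A u w ℕ.* N w))))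
                          (≡.cong (c *_) (∑-ι (λ w → A u w ℕ.* N w)))

    eigenvalue-pos : ∀ {u w} → 0 ℕ.< A u w → 0# < λ′
    eigenvalue-pos {u} {w} 0<Auw = *-cancelˡ-< (0<x u) (begin-strict
      x u * 0#                       ≡⟨ zeroʳ (x u) ⟩
      0#                             <⟨ *-pos (0<ι 0<Auw) (0<x w) ⟩
      ι (A u w) * x w                ≤⟨ ∑-≥-term (λ v → 0≤* (0≤ι (A u v)) (inj₁ (0<x v))) w ⟩
      ∑ ℝ (λ v → ι (A u v) * x v)    ≡⟨ eigen u ⟩
      λ′ * x u                       ≡⟨ *-comm λ′ (x u) ⟩
      x u * λ′                       ∎)
      where open ≤-Reasoning

    equal-rows : ∀ {u v} → 0# < λ′ → (∀ w → A u w ≡ A v w) → x u ≡ x v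
    equal-rows {u} {v} 0<λ′ Au≡Av = *-cancelˡ-≡ 0<λ′
      (≡.trans (≡.sym (eigen u)) (≡.trans (∑-cong (λ w → ≡.cong (λ a → ι a * x w) (Au≡Av w))) (eigen v)))

    eigenvalue-bound : ∀ (N : Fin (suc n) → ℕ) (Rn Rd : ℕ) → (∀ w → 0 ℕ.< N w) →
                       (∀ u → rowSum N u ℕ.* Rd ℕ.≤ N u ℕ.* Rn) → λ′ * ι Rd ≤ ι Rn
    eigenvalue-bound N Rn Rd 0<N row≤ = from-max-ratio (max-ratio x (λ w → ι (N w)) (λ w → 0<ι (0<N w)) 0<x)
      where
      from-max-ratio : (∃[ i ] ∃[ C ] 0# < C × (∀ w → x w ≤ C * ι (N w)) × x i ≡ C * ι (N i)) →
                       λ′ * ι Rd ≤ ι Rn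
      from-max-ratio (i , C , 0<C , x≤CN , xi≡CNi) = *-cancelˡ-≤ (0<ι (0<N i)) (begin
        ι (N i) * (λ′ * ι Rd)     ≡⟨ solve 3 (λ a l r → a :* (l :* r) := l :* a :* r) ≡.refl (ι (N i)) λ′ (ι Rd) ⟩
        λ′ * ι (N i) * ι Rd       ≤⟨ *-monoʳ-≤ (0≤ι Rd) λNi≤row ⟩
        ι (rowSum N i) * ι Rd     ≡⟨ ι-* (rowSum N i) Rd ⟨
        ι (rowSum N i ℕ.* Rd)     ≤⟨ ι-mono-≤ (row≤ i) ⟩
        ι (N i ℕ.* Rn)            ≡⟨ ι-* (N i) Rn ⟩
        ι (N i) * ι Rn            ∎)
        where
        open ≤-Reasoning
        λNi≤row : λ′ * ι (N i) ≤ ι (rowSum N i)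
        λNi≤row = *-cancelˡ-≤ 0<C (begin
          C * (λ′ * ι (N i))                     ≡⟨ solve 3 (λ c l a → c :* (l :* a) := l :* (c :* a))
                                                             ≡.refl C λ′ (ι (N i)) ⟩
          λ′ * (C * ι (N i))                     ≡⟨ ≡.cong (λ′ *_) xi≡CNi ⟨
          λ′ * x i                               ≡⟨ eigen i ⟨
          ∑ ℝ (λ w → ι (A i w) * x w)            ≤⟨ ∑-mono-≤ (λ w → *-monoˡ-≤ (0≤ι (A i w)) (x≤CN w)) ⟩
          ∑ ℝ (λ w → ι (A i w) * (C * ι (N w)))  ≡⟨ ∑-cong (λ w → ι-*-scaled C (A i w) (N w)) ⟩
          ∑ ℝ (λ w → C * ι (A i w ℕ.* N w))      ≡⟨ row-ι C N i ⟩
          C * ι (rowSum N i)                     ∎)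

    module Steps {c : Carrier} (N : Fin (suc n) → ℕ) (Rn Rd : ℕ) (0<c : 0# < c)
                 (cN≤x : ∀ w → c * ι (N w) ≤ x w) (λRd≤Rn : λ′ * ι Rd ≤ ι Rn) where
      open ScaledBounds x c N

      next : Fin (suc n) → Fin (suc n) → ℕ × ℕ → ℕ × ℕ
      next v j (U , D) = Rn ℕ.* U ℕ.+ A v j ℕ.* N j ℕ.* (Rd ℕ.* D) ℕ.∸ rowSum N v ℕ.* (Rd ℕ.* D)
                       , A v j ℕ.* (Rd ℕ.* D)

      step : ∀ {v j b} → ScaledBound v b → ScaledBound j (next v j b)
      step {v} {j} {U , D} (scaled xvD≤cU) = scaled $
        ≡.subst (_≤ c * ι (proj₁ (next v j (U , D)))) (ι-*-swap (A v j) (x j) (Rd ℕ.* D))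
          (isolate-term (rowSum N v) (A v j ℕ.* N j) (Rd ℕ.* D) (Rn ℕ.* U) (inj₁ 0<c) others λxvK≤cRnU)
        where
        others : c * ι (rowSum N v) + ι (A v j) * x j ≤ λ′ * x v + c * ι (A v j ℕ.* N j)
        others = ≡.subst₂ _≤_ (≡.cong (_+ ι (A v j) * x j) (row-ι c N v)) (≡.cong (_+ c * ι (A v j ℕ.* N j)) (eigen v))
          (∑-exchange (λ w → ≡.subst (_≤ ι (A v w) * x w) (ι-*-scaled c (A v w) (N w))
                                     (*-monoˡ-≤ (0≤ι (A v w)) (cN≤x w))) j)
        λxvK≤cRnU : λ′ * x v * ι (Rd ℕ.* D) ≤ c * ι (Rn ℕ.* U)
        λxvK≤cRnU = begin
          λ′ * x v * ι (Rd ℕ.* D)         ≡⟨ ≡.cong (λ′ * x v *_) (ι-* Rd D) ⟩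
          λ′ * x v * (ι Rd * ι D)         ≡⟨ solve 4 (λ l y r d → l :* y :* (r :* d) := y :* d :* (l :* r))
                                                     ≡.refl λ′ (x v) (ι Rd) (ι D) ⟩
          x v * ι D * (λ′ * ι Rd)         ≤⟨ *-mono-≤ (0≤* (inj₁ (0<x v)) (0≤ι D)) (0≤ι Rn) xvD≤cU λRd≤Rn ⟩
          c * ι U * ι Rn                  ≡⟨ solve 3 (λ c u r → c :* u :* r := c :* (r :* u)) ≡.refl c (ι U) (ι Rn) ⟩
          c * (ι Rn * ι U)                ≡⟨ ≡.cong (c *_) (ι-* Rn U) ⟨
          c * ι (Rn ℕ.* U)                ∎
          where open ≤-Reasoning

  termℕ : ∀ {n} → (Fin n → ℕ) → Fin n → Edge n → ℕ
  termℕ N i (a , b , d) with i Fin.≟ a | i Fin.≟ b | i Fin.≟ d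
  ... | yes _ | _     | _     = N b ℕ.* N d
  ... | no _  | yes _ | _     = N a ℕ.* N d
  ... | no _  | no _  | yes _ = N a ℕ.* N b
  ... | no _  | no _  | no _  = 0

  module _ {n : ℕ} where

    term-ι : ∀ (N : Fin n → ℕ) i e → term ℝ (λ w → ι (N w)) i e ≡ ι (termℕ N i e)
    term-ι N i (a , b , d) with i Fin.≟ a | i Fin.≟ b | i Fin.≟ d
    ... | yes _ | _     | _     = ≡.sym (ι-* (N b) (N d))
    ... | no _  | yes _ | _     = ≡.sym (ι-* (N a) (N d))
    ... | no _  | no _  | yes _ = ≡.sym (ι-* (N a) (N b))
    ... | no _  | no _  | no _  = ≡.refl

    term-scale : ∀ c (z : Fin n → Carrier) i e → term ℝ (λ w → c * z w) i e ≡ (c * c) * term ℝ z i e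
    term-scale c z i (a , b , d) with i Fin.≟ a | i Fin.≟ b | i Fin.≟ d
    ... | yes _ | _     | _     = *-scale-square c (z b) (z d)
    ... | no _  | yes _ | _     = *-scale-square c (z a) (z d)
    ... | no _  | no _  | yes _ = *-scale-square c (z a) (z b)
    ... | no _  | no _  | no _  = ≡.sym (zeroʳ (c * c))

    term-mono : ∀ {y y′ : Fin n → Carrier} → (∀ w → 0# ≤ y w) → (∀ w → y w ≤ y′ w) →
                ∀ i e → term ℝ y i e ≤ term ℝ y′ i e
    term-mono {y} {y′} 0≤y y≤y′ i (a , b , d) with i Fin.≟ a | i Fin.≟ b | i Fin.≟ d
    ... | yes _ | _     | _     = *-mono-≤ (0≤y b) (≤-trans (0≤y d) (y≤y′ d)) (y≤y′ b) (y≤y′ d)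
    ... | no _  | yes _ | _     = *-mono-≤ (0≤y a) (≤-trans (0≤y d) (y≤y′ d)) (y≤y′ a) (y≤y′ d)
    ... | no _  | no _  | yes _ = *-mono-≤ (0≤y a) (≤-trans (0≤y b) (y≤y′ b)) (y≤y′ a) (y≤y′ b)
    ... | no _  | no _  | no _  = ≤-refl

    term-∉ : ∀ (y : Fin n → Carrier) v e → inE v e ≡ false → term ℝ y v e ≡ 0#
    term-∉ y v (a , b , d) v∉e with v Fin.≟ a | v Fin.≟ b | v Fin.≟ d
    term-∉ y v (a , b , d) () | yes _ | _     | _
    term-∉ y v (a , b , d) () | no _  | yes _ | _
    term-∉ y v (a , b , d) () | no _  | no _  | yes _
    term-∉ y v (a , b , d) _  | no _  | no _  | no _  = ≡.refl

    term-scaled-ι : ∀ c (N : Fin n → ℕ) i e → term ℝ (λ w → c * ι (N w)) i e ≡ c * c * ι (termℕ N i e)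
    term-scaled-ι c N i e = ≡.trans (term-scale c _ i e) (≡.cong (c * c *_) (term-ι N i e))

    incident : Fin n → Hypergraph3 n → Hypergraph3 n
    incident v = filter (λ e → T? (inE v e))

    ∑E-incident : ∀ (H : Hypergraph3 n) y v → ∑E ℝ H (term ℝ y v) ≡ ∑E ℝ (incident v H) (term ℝ y v)
    ∑E-incident []      y v = ≡.refl
    ∑E-incident (e ∷ H) y v with inE v e in v∈?e
    ... | true  = ≡.cong (term ℝ y v e +_) (∑E-incident H y v)
    ... | false = ≡.trans (≡.cong₂ _+_ (term-∉ y v e v∈?e) (∑E-incident H y v)) (+-identityˡ _)

  module HypergraphBounds {n : ℕ} (H : Hypergraph3 (suc n)) {ρ : Carrier} {y : Fin (suc n) → Carrier}
                          (eigen : IsEigenpair ℝ H ρ y) (0<y : ∀ w → 0# < y w) where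

    edgeSum : (Fin (suc n) → ℕ) → Fin (suc n) → ℕ
    edgeSum N v = sum (map (termℕ N v) H)

    edge-ι : ∀ c (N : Fin (suc n) → ℕ) v → ∑E ℝ H (λ e → c * ι (termℕ N v e)) ≡ c * ι (edgeSum N v)
    edge-ι c N v = ≡.trans (≡.sym (*-distribˡ-∑E H c (λ e → ι (termℕ N v e))))
                           (≡.cong (c *_) (∑E-ι H (termℕ N v)))

    scaled-term≤ : ∀ {c} (N : Fin (suc n) → ℕ) → 0# ≤ c → (∀ w → c * ι (N w) ≤ y w) →
                   ∀ v e → c * c * ι (termℕ N v e) ≤ term ℝ y v e
    scaled-term≤ {c} N 0≤c cN≤y v e =
      ≡.subst (_≤ term ℝ y v e) (term-scaled-ι c N v e) (term-mono (λ w → 0≤* 0≤c (0≤ι (N w))) cN≤y v e)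

    eigenvalue-bound : ∀ (N : Fin (suc n) → ℕ) (Rn Rd : ℕ) → (∀ w → 0 ℕ.< N w) →
                       (∀ u → edgeSum N u ℕ.* Rd ℕ.≤ N u ℕ.* N u ℕ.* Rn) → ρ * ι Rd ≤ ι Rn
    eigenvalue-bound N Rn Rd 0<N edge≤ = from-max-ratio (max-ratio y (λ w → ι (N w)) (λ w → 0<ι (0<N w)) 0<y)
      where
      from-max-ratio : (∃[ i ] ∃[ C ] 0# < C × (∀ w → y w ≤ C * ι (N w)) × y i ≡ C * ι (N i)) →
                       ρ * ι Rd ≤ ι Rn
      from-max-ratio (i , C , 0<C , y≤CN , yi≡CNi) = *-cancelˡ-≤ (*-pos (0<ι (0<N i)) (0<ι (0<N i))) (begin
        Ni² * (ρ * ι Rd)              ≡⟨ solve 3 (λ a p r → a :* (p :* r) := p :* a :* r) ≡.refl Ni² ρ (ι Rd) ⟩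
        ρ * Ni² * ι Rd                ≤⟨ *-monoʳ-≤ (0≤ι Rd) ρNi²≤edge ⟩
        ι (edgeSum N i) * ι Rd        ≡⟨ ι-* (edgeSum N i) Rd ⟨
        ι (edgeSum N i ℕ.* Rd)        ≤⟨ ι-mono-≤ (edge≤ i) ⟩
        ι (N i ℕ.* N i ℕ.* Rn)        ≡⟨ ι-*₃ (N i) (N i) Rn ⟩
        Ni² * ι Rn                    ∎)
        where
        open ≤-Reasoning
        Ni² : Carrier
        Ni² = ι (N i) * ι (N i)
        ρNi²≤edge : ρ * Ni² ≤ ι (edgeSum N i)
        ρNi²≤edge = *-cancelˡ-≤ (*-pos 0<C 0<C) (begin
          C * C * (ρ * Ni²)                        ≡⟨ solve 3 (λ c p a → c :* c :* (p :* (a :* a)) := p :* (c :* a :* (c :* a)))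
                                                               ≡.refl C ρ (ι (N i)) ⟩
          ρ * (C * ι (N i) * (C * ι (N i)))        ≡⟨ ≡.cong (λ t → ρ * (t * t)) yi≡CNi ⟨
          ρ * (y i * y i)                          ≡⟨ eigen i ⟩
          ∑E ℝ H (term ℝ y i)                      ≤⟨ ∑E-mono-≤ H (term-mono (λ w → inj₁ (0<y w)) y≤CN i) ⟩
          ∑E ℝ H (term ℝ (λ w → C * ι (N w)) i)    ≡⟨ ∑E-cong H (term-scaled-ι C N i) ⟩
          ∑E ℝ H (λ e → C * C * ι (termℕ N i e))   ≡⟨ edge-ι (C * C) N i ⟩
          C * C * ι (edgeSum N i)                  ∎)

    module Steps {c : Carrier} (N : Fin (suc n) → ℕ) (Rn Rd : ℕ) (0<c : 0# < c)
                 (cN≤y : ∀ w → c * ι (N w) ≤ y w) (ρRd≤Rn : ρ * ι Rd ≤ ι Rn) where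
      open ScaledBounds y c N

      next : Fin (suc n) → Edge (suc n) → Fin (suc n) → ℕ × ℕ → ℕ × ℕ
      next v e k (U , D) = let K = Rd ℕ.* D ℕ.* D in
        Rn ℕ.* U ℕ.* U ℕ.+ termℕ N v e ℕ.* K ℕ.∸ edgeSum N v ℕ.* K , N k ℕ.* K

      step : ∀ {v e j k b} → e ∈ H → term ℝ y v e ≡ y j * y k → ScaledBound v b → ScaledBound j (next v e k b)
      step {v} {e} {j} {k} {U , D} e∈H yjyk (scaled yvD≤cU) = scaled $ *-cancelˡ-≤ 0<c (begin
        c * (y j * ι (N k ℕ.* K))          ≡⟨ ≡.cong (λ t → c * (y j * t)) (ι-* (N k) K) ⟩
        c * (y j * (ι (N k) * ι K))        ≡⟨ solve 4 (λ c a m k → c :* (a :* (m :* k)) := a :* (c :* m) :* k)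
                                                     ≡.refl c (y j) (ι (N k)) (ι K) ⟩
        y j * (c * ι (N k)) * ι K          ≤⟨ *-monoʳ-≤ (0≤ι K) (*-monoˡ-≤ (inj₁ (0<y j)) (cN≤y k)) ⟩
        y j * y k * ι K                    ≤⟨ isolate-term (edgeSum N v) (termℕ N v e) K (Rn ℕ.* U ℕ.* U)
                                                           (0≤* (inj₁ 0<c) (inj₁ 0<c)) others ρyv²K≤c²RnU² ⟩
        c * c * ι M                        ≡⟨ *-assoc c c (ι M) ⟩
        c * (c * ι M)                      ∎)
        where
        open ≤-Reasoning
        K M : ℕ
        K = Rd ℕ.* D ℕ.* D
        M = Rn ℕ.* U ℕ.* U ℕ.+ termℕ N v e ℕ.* K ℕ.∸ edgeSum N v ℕ.* K
        others : c * c * ι (edgeSum N v) + y j * y k ≤ ρ * (y v * y v) + c * c * ι (termℕ N v e)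
        others = ≡.subst₂ _≤_ (≡.cong₂ _+_ (edge-ι (c * c) N v) yjyk) (≡.cong (_+ _) (≡.sym (eigen v)))
          (∑E-exchange (scaled-term≤ N (inj₁ 0<c) cN≤y v) e∈H)
        yvD≥0 : 0# ≤ y v * ι D
        yvD≥0 = 0≤* (inj₁ (0<y v)) (0≤ι D)
        ρyv²K≤c²RnU² : ρ * (y v * y v) * ι K ≤ c * c * ι (Rn ℕ.* U ℕ.* U)
        ρyv²K≤c²RnU² = begin
          ρ * (y v * y v) * ι K                  ≡⟨ ≡.cong (ρ * (y v * y v) *_) (ι-*₃ Rd D D) ⟩
          ρ * (y v * y v) * (ι Rd * ι D * ι D)   ≡⟨ solve 4 (λ p a r d → p :* (a :* a) :* (r :* d :* d)
                                                                      := a :* d :* (a :* d) :* (p :* r))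
                                                             ≡.refl ρ (y v) (ι Rd) (ι D) ⟩
          y v * ι D * (y v * ι D) * (ρ * ι Rd)   ≤⟨ *-mono-≤ (0≤* yvD≥0 yvD≥0) (0≤ι Rn)
                                                             (*-mono-≤ yvD≥0 (≤-trans yvD≥0 yvD≤cU) yvD≤cU yvD≤cU) ρRd≤Rn ⟩
          c * ι U * (c * ι U) * ι Rn             ≡⟨ solve 3 (λ c u r → c :* u :* (c :* u) :* r := c :* c :* (r :* u :* u))
                                                             ≡.refl c (ι U) (ι Rn) ⟩
          c * c * (ι Rn * ι U * ι U)             ≡⟨ ≡.cong (c * c *_) (ι-*₃ Rn U U) ⟨
          c * c * ι (Rn ℕ.* U ℕ.* U)             ∎

  -- The hypergraph O-R

  module O-R-Shadow {λ′ : Carrier} {x : Fin 7 → Carrier} (principal : IsShadowPrincipal ℝ O-R λ′ x) where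
    open Vertices
    open MatrixBounds (shadowAdj ℝ O-R) (proj₁ principal) (proj₁ (proj₂ principal))

    t≡b : x t ≡ x b
    t≡b = equal-rows (eigenvalue-pos {t} {p} ℕ.z<s)
                     (from-yes (all? (λ w → shadowAdj ℝ O-R t w ℕ.≟ shadowAdj ℝ O-R b w)))

  module O-R-Hypergraph {ρ : Carrier} {y : Fin 7 → Carrier} (principal : IsPrincipalEigenpair ℝ O-R ρ y) where
    open Vertices
    private
      0<y : ∀ w → 0# < y w
      0<y = proj₁ (proj₂ principal)

      eigen-at : ∀ v → ρ * (y v * y v) ≡ ∑E ℝ (incident v O-R) (term ℝ y v)
      eigen-at v = ≡.trans (proj₁ principal v) (∑E-incident O-R y v)

      at-t : ρ * (y t * y t) ≡ y p * y q + y r * y s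
      at-t = ≡.trans (eigen-at t) (≡.cong (y p * y q +_) (+-identityʳ _))
      at-b : ρ * (y b * y b) ≡ y q * y r + y p * y s
      at-b = ≡.trans (eigen-at b) (≡.cong (y q * y r +_) (+-identityʳ _))
      at-p : ρ * (y p * y p) ≡ y t * y q + (y b * y s + y u * y q)
      at-p = ≡.trans (eigen-at p) (≡.cong (λ a → y t * y q + (y b * y s + a)) (+-identityʳ _))
      at-q : ρ * (y q * y q) ≡ y t * y p + (y b * y r + y u * y p)
      at-q = ≡.trans (eigen-at q) (≡.cong (λ a → y t * y p + (y b * y r + a)) (+-identityʳ _))
      at-r : ρ * (y r * y r) ≡ y t * y s + y b * y q
      at-r = ≡.trans (eigen-at r) (≡.cong (y t * y s +_) (+-identityʳ _))
      at-s : ρ * (y s * y s) ≡ y t * y r + y b * y p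
      at-s = ≡.trans (eigen-at s) (≡.cong (y t * y r +_) (+-identityʳ _))

      equal-sides : ∀ {v w R S} → ρ * (y v * y v) ≡ R → ρ * (y w * y w) ≡ S → y v ≡ y w → R - S ≡ 0#
      equal-sides at-v at-w yv≡yw =
        x≡y⇒x-y≡0 (≡.trans (≡.sym at-v) (≡.trans (≡.cong (λ a → ρ * (a * a)) yv≡yw) at-w))

      vanishing : ∀ {d e} → d ≡ 0# → e ≡ 0# → ∀ f → d + e * f ≡ 0#
      vanishing ≡.refl ≡.refl f = ≡.trans (+-identityˡ _) (zeroˡ f)

      [p-r][q-s]≡[t]-[b] : (y p - y r) * (y q - y s) ≡ y p * y q + y r * y s - (y q * y r + y p * y s)
      [p-r][q-s]≡[t]-[b] = solve 4 (λ p q r s → (p :- r) :* (q :- s) := p :* q :+ r :* s :- (q :* r :+ p :* s))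
                                   ≡.refl (y p) (y q) (y r) (y s)

    t≢b : y t ≢ y b
    t≢b t≡b with zero-product (≡.trans [p-r][q-s]≡[t]-[b] (equal-sides at-t at-b t≡b))
    ... | inj₁ p-r≡0 = <⇒≢ (*-pos (0<y u) (0<y q)) (≡.sym (begin
      y u * y q
        ≡⟨ solve 5 (λ t b q s u → u :* q := (t :* q :+ (b :* s :+ u :* q)) :- (t :* s :+ b :* q) :+ (b :- t) :* (q :- s))
                   ≡.refl (y t) (y b) (y q) (y s) (y u) ⟩
      (y t * y q + (y b * y s + y u * y q)) - (y t * y s + y b * y q) + (y b - y t) * (y q - y s)
        ≡⟨ vanishing (equal-sides at-p at-r (x-y≡0⇒x≡y p-r≡0)) (x≡y⇒x-y≡0 (≡.sym t≡b)) (y q - y s) ⟩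
      0#
        ∎))
      where open ≡.≡-Reasoning
    ... | inj₂ q-s≡0 = <⇒≢ (*-pos (0<y u) (0<y p)) (≡.sym (begin
      y u * y p
        ≡⟨ solve 5 (λ t b p r u → u :* p := (t :* p :+ (b :* r :+ u :* p)) :- (t :* r :+ b :* p) :+ (b :- t) :* (p :- r))
                   ≡.refl (y t) (y b) (y p) (y r) (y u) ⟩
      (y t * y p + (y b * y r + y u * y p)) - (y t * y r + y b * y p) + (y b - y t) * (y p - y r)
        ≡⟨ vanishing (equal-sides at-q at-s (x-y≡0⇒x≡y q-s≡0)) (x≡y⇒x-y≡0 (≡.sym t≡b)) (y p - y r) ⟩
      0#
        ∎))
      where open ≡.≡-Reasoning

  module _ where
    open Vertices

    O-R-opaque : Opaque ℝ O-R
    O-R-opaque ρ y λ′ x principal shadow with compare (y t) (y b)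
    ... | tri< t<b _ _ = ranking-differs t<b (inj₂ (≡.sym (O-R-Shadow.t≡b shadow)))
    ... | tri≈ _ t≡b _ = ⊥-elim (O-R-Hypergraph.t≢b principal t≡b)
    ... | tri> _ _ b<t = ranking-differs b<t (inj₂ (O-R-Shadow.t≡b shadow))

  -- The hypergraph O-B

  module O-B-Hypergraph {ρ : Carrier} {y : Fin 7 → Carrier} (principal : IsPrincipalEigenpair ℝ O-B ρ y) where
    open Vertices
    private
      eigen : IsEigenpair ℝ O-B ρ y
      eigen = proj₁ principal
      0<y : ∀ w → 0# < y w
      0<y = proj₁ (proj₂ principal)

      -- 10⁴ · y, rounded
      N : Fin 7 → ℕ
      N = lookup (5364 ∷ 5025 ∷ 6515 ∷ 4963 ∷ 5116 ∷ 5116 ∷ 3736 ∷ [])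

      0<N : ∀ w → 0 ℕ.< N w
      0<N = from-yes (all? (λ w → 0 ℕ.<? N w))

    open HypergraphBounds O-B eigen 0<y

    ρ-bound : ρ * ι 1000000 ≤ ι 2317465
    ρ-bound = eigenvalue-bound N 2317465 1000000 0<N
      (from-yes (all? (λ u → edgeSum N u ℕ.* 1000000 ℕ.≤? N u ℕ.* N u ℕ.* 2317465)))

    module Paths {c : Carrier} (0<c : 0# < c) (cN≤y : ∀ w → c * ι (N w) ≤ y w) where
      open ScaledBounds y c N
      open Steps N 2317465 1000000 0<c cN≤y ρ-bound

      separate : ∀ {bd} → ScaledBound q bd → True (proj₁ bd ℕ.<? N b ℕ.* proj₂ bd) → y q < y b
      separate bound U<NbD = bound-separates 0<c (cN≤y b) bound (toWitness U<NbD)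

      p→q : ∀ {bd} → ScaledBound p bd → ScaledBound q (next p (b , p , q) b bd)
      p→q = step (there (there (here ≡.refl))) (*-comm (y b) (y q))

      -- One clause per touching vertex, in the order t, b, p, q, r, s, u.
      from : ∀ i → y i ≡ c * ι (N i) → y q < y b
      from zero e = separate (p→q (step (here ≡.refl) ≡.refl (bound-at-touch e))) _
      from (suc zero) e =
        separate (step (there (there (here ≡.refl))) (*-comm (y p) (y q)) (bound-at-touch e)) _
      from (suc (suc zero)) e = separate (p→q (bound-at-touch e)) _
      from (suc (suc (suc zero))) e = separate (bound-at-touch e) _
      from (suc (suc (suc (suc zero)))) e =
        separate (p→q (step (here ≡.refl) (*-comm (y t) (y p)) (bound-at-touch e))) _
      from (suc (suc (suc (suc (suc zero))))) e =
        separate (p→q (step (there (here ≡.refl)) (*-comm (y t) (y p)) (bound-at-touch e))) _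
      from (suc (suc (suc (suc (suc (suc zero)))))) e =
        separate (step (there (there (there (there (here ≡.refl))))) (*-comm (y p) (y q)) (bound-at-touch e)) _

    q<b : y q < y b
    q<b = let i , c , 0<c , cN≤y , yi≡cNi = min-ratio y (λ w → ι (N w)) (λ w → 0<ι (0<N w)) 0<y
          in Paths.from 0<c cN≤y i yi≡cNi

  module O-B-Shadow {λ′ : Carrier} {x : Fin 7 → Carrier} (principal : IsShadowPrincipal ℝ O-B λ′ x) where
    open Vertices
    private
      eigen : ∀ v → ∑ ℝ (λ w → ι (shadowAdj ℝ O-B v w) * x w) ≡ λ′ * x v
      eigen = proj₁ principal
      0<x : ∀ w → 0# < x w
      0<x = proj₁ (proj₂ principal)

      -- 10⁴ · x, rounded
      N : Fin 7 → ℕ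
      N = lookup (3877 ∷ 3418 ∷ 5724 ∷ 3544 ∷ 3475 ∷ 3475 ∷ 1953 ∷ [])

      0<N : ∀ w → 0 ℕ.< N w
      0<N = from-yes (all? (λ w → 0 ℕ.<? N w))

    open MatrixBounds (shadowAdj ℝ O-B) eigen 0<x

    λ-bound : λ′ * ι 1000000 ≤ ι 4746475
    λ-bound = eigenvalue-bound N 4746475 1000000 0<N
      (from-yes (all? (λ u → rowSum N u ℕ.* 1000000 ℕ.≤? N u ℕ.* 4746475)))

    module Paths {c : Carrier} (0<c : 0# < c) (cN≤x : ∀ w → c * ι (N w) ≤ x w) where
      open ScaledBounds x c N
      open Steps N 4746475 1000000 0<c cN≤x λ-bound

      separate : ∀ {bd} → ScaledBound b bd → True (proj₁ bd ℕ.<? N q ℕ.* proj₂ bd) → x b < x q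
      separate bound U<NqD = bound-separates 0<c (cN≤x q) bound (toWitness U<NqD)

      from : ∀ i → x i ≡ c * ι (N i) → x b < x q
      from zero e = separate (step {v = p} {j = b} (step {v = t} {j = p} (bound-at-touch e))) _
      from (suc zero) e = separate (bound-at-touch e) _
      from (suc (suc zero)) e = separate (step {v = p} {j = b} (bound-at-touch e)) _
      from (suc (suc (suc zero))) e = separate (step {v = q} {j = b} (bound-at-touch e)) _
      from (suc (suc (suc (suc zero)))) e = separate (step {v = r} {j = b} (bound-at-touch e)) _
      from (suc (suc (suc (suc (suc zero))))) e = separate (step {v = s} {j = b} (bound-at-touch e)) _
      from (suc (suc (suc (suc (suc (suc zero)))))) e =
        separate (step {v = q} {j = b} (step {v = u} {j = q} (bound-at-touch e))) _

    b<q : x b < x q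
    b<q = let i , c , 0<c , cN≤x , xi≡cNi = min-ratio x (λ w → ι (N w)) (λ w → 0<ι (0<N w)) 0<x
          in Paths.from 0<c cN≤x i xi≡cNi

  O-B-opaque : Opaque ℝ O-B
  O-B-opaque ρ y λ′ x principal shadow =
    ranking-differs (O-B-Hypergraph.q<b principal) (inj₁ (O-B-Shadow.b<q shadow))

theorem4 : (ℝ : RealField) → Opaque ℝ O-R × Opaque ℝ O-B
theorem4 ℝ = Opacity.O-R-opaque ℝ , Opacity.O-B-opaque ℝ
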